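{- Let $n\ge1$ and $N=2^n$. For every graph $G\subseteq[N]\times[N]$, $\rho_{\mathsf{ultra}}(G,\mathcal G_{N,N})\le\rho_{\mathsf{ultra}}(f_G^{ -1}(1),\mathcal B_{2n})$, where $f_G\colon\{0,1\}^{2n}\to\{0,1\}$ is the Boolean function associated with $G$.
   Context: For a ground set $\Gamma$, generators $\mathcal B\subseteq\mathcal P(\Gamma)$, and $A\subseteq\Gamma$, let $U=\Gamma\setminus A$. A semi-filter over $U$ is a nonempty family $\mathcal F\subseteq\mathcal P(U)$ with $\emptyset\notin\mathcal F$ that is upward closed within $\mathcal P(U)$; it is a semi-ultra-filter if for every $W\subseteq U$, $W\in\mathcal F$ or $U\setminus W\in\mathcal F$. $\mathcal F$ is above $w\in\Gamma$ if $B\cap U\in\mathcal F$ for every $B\in\mathcal B$ with $w\in B$. A pair $(E,H)$ of subsets of $U$ covers $\mathcal F$ if $E,H\in\mathcal F$ but $E\cap H\notin\mathcal F$. $\rho_{\mathsf{ultra}}(A,\mathcal B)$ is the minimum number of pairs of subsets of $U$ such that every semi-ultra-filter over $U$ above some $a\in A$ is covered by one of them. $\mathcal G_{N,N}=\{R_1,\dots,R_N,C_1,\dots,C_N\}$ on $[N]\times[N]$, $R_i=\{(i,j):j\in[N]\}$, $C_j=\{(i,j):i\in[N]\}$. $\mathcal B_{2n}=\{B_1,\dots,B_{2n},B_1^c,\dots,B_{2n}^c\}$ on $\{0,1\}^{2n}$, $B_i=\{v:v_i=1\}$. $\mathrm{bin}\colon[N]\to\{0,1\}^n$ maps $k$ to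 the $n$-bit binary representation (most significant first) of $k-1$; $\phi(u,v)=\mathrm{bin}(u)\mathrm{bin}(v)$; $f_G^{ -1}(1)=\phi(G)$. -}

module Defs where

open import Data.Bool using (Bool; true; false; not; _∧_; _∨_)
open import Data.Nat using (ℕ; zero; suc; _+_; _^_; _%_; _/_; _≡ᵇ_)
open import Data.Fin using (Fin; toℕ)
import Data.Fin as Fin
open import Data.Vec using (Vec; []; _∷_; _++_; lookup; reverse)
open import Data.Vec.Properties using (≡-dec)
open import Data.List using (List)
open import Data.List.Relation.Unary.All using (All)
open import Data.List.Relation.Unary.Any using (Any)
open import Data.Product using (Σ; ∃; _×_; _,_)
open import Data.Sum using (_⊎_; inj₁; inj₂)
open import Relation.Binary.PropositionalEquality using (_≡_)
open import Relation.Nullary using (¬_)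
open import Relation.Nullary.Decidable using (⌊_⌋)
import Data.Bool.Properties as BoolP

Subset : Set → Set
Subset Γ = Γ → Bool

module _ {Γ : Set} where

  _⊆_ : Subset Γ → Subset Γ → Set
  W ⊆ V = ∀ x → W x ≡ true → V x ≡ true

  _∩_ : Subset Γ → Subset Γ → Subset Γ
  (W ∩ V) x = W x ∧ V x

  _∖_ : Subset Γ → Subset Γ → Subset Γ
  (V ∖ W) x = V x ∧ not (W x)

  complement : Subset Γ → Subset Γ
  complement A x = not (A x)

  IsEmpty : Subset Γ → Set
  IsEmpty W = ∀ x → W x ≡ false

-- A family of subsets of Γ (a subset of P(Γ)); Γ is finite in all uses,
-- so P(P(Γ)) is finite and a family is a Boolean predicate on subsets.
Family : Set → Set
Family Γ = Subset Γ → Bool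

module _ {Γ : Set} where

  record IsSemiFilter (U : Subset Γ) (F : Family Γ) : Set where
    field
      within    : ∀ W → F W ≡ true → W ⊆ U
      nonempty  : ∃ λ W → F W ≡ true
      no-empty  : ∀ W → F W ≡ true → ¬ IsEmpty W
      upward    : ∀ W W′ → F W ≡ true → W ⊆ W′ → W′ ⊆ U → F W′ ≡ true

  record IsSemiUltraFilter (U : Subset Γ) (F : Family Γ) : Set where
    field
      semiFilter : IsSemiFilter U F
      ultra      : ∀ W → W ⊆ U → F W ≡ true ⊎ F (U ∖ W) ≡ true

  -- F is above w w.r.t. the generators gen : I → P(Γ) (B = image of gen)
  Above : {I : Set} → (I → Subset Γ) → Subset Γ → Family Γ → Γ → Set
  Above gen U F w = ∀ i → gen i w ≡ true → F (gen i ∩ U) ≡ true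

  Covers : Family Γ → Subset Γ × Subset Γ → Set
  Covers F (E , H) = F E ≡ true × F H ≡ true × F (E ∩ H) ≡ false

  -- L is a list of pairs of subsets of U = Γ ∖ A such that every
  -- semi-ultra-filter over U above some a ∈ A is covered by one of them.
  -- ρ_ultra(A, B) is the minimum length of such a list.
  IsUltraCover : {I : Set} → Subset Γ → (I → Subset Γ) →
                 List (Subset Γ × Subset Γ) → Set
  IsUltraCover A gen L =
    All (λ { (E , H) → E ⊆ complement A × H ⊆ complement A }) L ×
    (∀ (F : Family Γ) → IsSemiUltraFilter (complement A) F →
       ∀ a → A a ≡ true → Above gen (complement A) F a →
       Any (Covers F) L)

-- The grid generators G_{N,N} on [N] × [N]  (Fin N represents [N], k ↦ k-1)

data RowCol (N : ℕ) : Set where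
  row : Fin N → RowCol N
  col : Fin N → RowCol N

gridGen : (N : ℕ) → RowCol N → Subset (Fin N × Fin N)
gridGen N (row i) (u , v) = ⌊ u Fin.≟ i ⌋
gridGen N (col j) (u , v) = ⌊ v Fin.≟ j ⌋

-- The cube generators B_{2n} = {B_i , B_i^c} on {0,1}^{2n} = Vec Bool (n + n)

cubeGen : (m : ℕ) → Fin m × Bool → Subset (Vec Bool m)
cubeGen m (i , true)  v = lookup v i
cubeGen m (i , false) v = not (lookup v i)

bitsLSB : (n : ℕ) → ℕ → Vec Bool n
bitsLSB zero    m = []
bitsLSB (suc n) m = (m % 2 ≡ᵇ 1) ∷ bitsLSB n (m / 2)

-- bin k = n-bit binary representation (MSB first) of k - 1, for k ∈ [N];
-- with Fin N representing [N] via k ↦ k - 1 this is the bits of toℕ k.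
bin : (n : ℕ) → Fin (2 ^ n) → Vec Bool n
bin n k = reverse (bitsLSB n (toℕ k))

φ : (n : ℕ) → Fin (2 ^ n) × Fin (2 ^ n) → Vec Bool (n + n)
φ n (u , v) = bin n u ++ bin n v

anyFin : {m : ℕ} → (Fin m → Bool) → Bool
anyFin {zero}  p = false
anyFin {suc m} p = p Fin.zero ∨ anyFin {m} (λ i → p (Fin.suc i))

Graph : ℕ → Set
Graph N = Fin N × Fin N → Bool

fG⁻¹1 : (n : ℕ) → Graph (2 ^ n) → Subset (Vec Bool (n + n))
fG⁻¹1 n G w = anyFin (λ u → anyFin (λ v →
  G (u , v) ∧ ⌊ ≡-dec BoolP._≟_ (φ n (u , v)) w ⌋))

{-# OPTIONS --safe #-}
-- A semi-ultra-filter F over the complement U of G, above a ∈ G, is pushed along the encoding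
-- φ to the family {W ⊆ V : φ⁻¹(W) ∩ U ∈ F} over the complement V of f_G⁻¹(1). Since φ is
-- injective, φ⁻¹(f_G⁻¹(1)) = G, so this family is again a semi-ultra-filter, and it lies above
-- φ(a): a cube generator through φ(a) fixes one bit of the row or of the column code, so its
-- preimage contains the whole row or column of a. Taking preimages of the pairs of a cover
-- therefore turns every cover on the cube side into a cover on the grid side of the same length.
module Submission where

open import Defs
open import Data.Bool using (Bool; true; false; not; _∧_; _∨_)
open import Data.Bool.Properties using (∧-conicalˡ; ∧-conicalʳ; ∨-zeroʳ; ¬-not; not-¬)
import Data.Bool.Properties as Bool
open import Data.Nat using (ℕ; zero; suc; _≤_; _<_; _^_; _+_; _*_; _%_; _/_; _≡ᵇ_; s≤s)
open import Data.Nat.Properties using (n<1⇒n≡0; ≤-reflexive; *-comm)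
open import Data.Nat.DivMod using (m≡m%n+[m/n]*n; m%n<n; m<n*o⇒m/o<n)
open import Data.Fin using (Fin; splitAt)
import Data.Fin as Fin
open import Data.Fin.Properties using (toℕ-injective; toℕ<n)
open import Data.Vec using (Vec; []; _∷_; _++_; lookup)
open import Data.Vec.Properties using (≡-dec; ∷-injective; ++-injective; reverse-injective; lookup-splitAt)
open import Data.List using (List; length; map)
open import Data.List.Properties using (length-map)
import Data.List.Relation.Unary.All as All
import Data.List.Relation.Unary.All.Properties as All
import Data.List.Relation.Unary.Any as Any
import Data.List.Relation.Unary.Any.Properties as Any
open import Data.Product using (Σ; ∃; _×_; _,_; proj₁; proj₂)
import Data.Product as Product
open import Data.Sum using (inj₁; inj₂; [_,_]′)
import Data.Sum as Sum
open import Function using (_∘_; id)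
open import Relation.Binary.PropositionalEquality
  using (_≡_; _≢_; _≗_; refl; sym; trans; cong; cong₂; subst; module ≡-Reasoning)
open import Relation.Nullary using (Dec; yes; contradiction)
open import Relation.Nullary.Decidable using (⌊_⌋; map′; _×-dec_; _→-dec_; isYes≗does; dec-true)
open import Relation.Unary using (Pred; Decidable)

∧-true⁺ : ∀ {x y} → x ≡ true → y ≡ true → x ∧ y ≡ true
∧-true⁺ refl refl = refl

∧-true⁻ : ∀ {x y} → x ∧ y ≡ true → x ≡ true × y ≡ true
∧-true⁻ p = ∧-conicalˡ _ _ p , ∧-conicalʳ _ _ p

module _ {A : Set} where

  ⌊⌋-true⁺ : (a? : Dec A) → A → ⌊ a? ⌋ ≡ true
  ⌊⌋-true⁺ a? a = trans (isYes≗does a?) (dec-true a? a)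

  ⌊⌋-true⁻ : (a? : Dec A) → ⌊ a? ⌋ ≡ true → A
  ⌊⌋-true⁻ (yes a) _ = a

Exhaustible : Set → Set₁
Exhaustible X = {P : Pred X _} → Decidable P → Dec (∀ x → P x)

Bool-exhaustible : Exhaustible Bool
Bool-exhaustible P? = map′ (λ (Pt , Pf) → λ { true → Pt ; false → Pf }) (λ P → P true , P false)
                           (P? true ×-dec P? false)

Vec-exhaustible : ∀ {X} → Exhaustible X → ∀ m → Exhaustible (Vec X m)
Vec-exhaustible X-exh zero    P? = map′ (λ P[] → λ { [] → P[] }) (λ P → P []) (P? [])
Vec-exhaustible X-exh (suc m) P? =
  map′ (λ P → λ { (x ∷ xs) → P x xs }) (λ P x xs → P (x ∷ xs))
       (X-exh (λ x → Vec-exhaustible X-exh m (λ xs → P? (x ∷ xs))))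

⊆-dec : ∀ {X} → Exhaustible X → (W W′ : Subset X) → Dec (W ⊆ W′)
⊆-dec X-exh W W′ = X-exh (λ x → (W x Bool.≟ true) →-dec (W′ x Bool.≟ true))

module _ {Γ : Set} {U : Subset Γ} {F : Family Γ} (isSF : IsSemiFilter U F) where
  open IsSemiFilter isSF

  semiFilter-∋U : F U ≡ true
  semiFilter-∋U = let W , FW = nonempty in upward W U FW (within W FW) (λ _ → id)

-- A strong form of continuity of h at a for the topologies generated by gen and gen′.
ContinuousAt : {Γ Δ I J : Set} → (I → Subset Γ) → (J → Subset Δ) → (Γ → Δ) → Γ → Set
ContinuousAt gen gen′ h a =
  ∀ i → gen′ i (h a) ≡ true → ∃ λ j → gen j a ≡ true × gen j ⊆ (gen′ i ∘ h)

module Pushforward {Γ Δ : Set} (Δ-exhaustible : Exhaustible Δ) (h : Γ → Δ)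
                   {A : Subset Γ} {B : Subset Δ} (B∘h≗A : B ∘ h ≗ A) where

  U : Subset Γ
  U = complement A

  V : Subset Δ
  V = complement B

  V∘h≗U : V ∘ h ≗ U
  V∘h≗U = cong not ∘ B∘h≗A

  preimage : Subset Δ → Subset Γ
  preimage W = (W ∘ h) ∩ U

  preimage² : Subset Δ × Subset Δ → Subset Γ × Subset Γ
  preimage² = Product.map preimage preimage

  preimage⊆U : ∀ W → preimage W ⊆ U
  preimage⊆U W x = proj₂ ∘ ∧-true⁻

  U⊆preimageV : U ⊆ preimage V
  U⊆preimageV x Ux = ∧-true⁺ (trans (V∘h≗U x) Ux) Ux

  preimage-mono : ∀ {W W′} → W ⊆ W′ → preimage W ⊆ preimage W′
  preimage-mono W⊆W′ x p = let Wx , Ux = ∧-true⁻ p in ∧-true⁺ (W⊆W′ (h x) Wx) Ux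

  ⊆preimage-∩V : ∀ {S W} → S ⊆ (W ∘ h) → (S ∩ U) ⊆ preimage (W ∩ V)
  ⊆preimage-∩V S⊆W∘h x p =
    let Sx , Ux = ∧-true⁻ p in ∧-true⁺ (∧-true⁺ (S⊆W∘h x Sx) (trans (V∘h≗U x) Ux)) Ux

  preimage-∩ : ∀ E H → (preimage E ∩ preimage H) ⊆ preimage (E ∩ H)
  preimage-∩ E H x p =
    let x∈preimageE , x∈preimageH = ∧-true⁻ {preimage E x} p
        Ex , Ux = ∧-true⁻ {E (h x)} x∈preimageE
    in  ∧-true⁺ {E (h x) ∧ H (h x)} (∧-true⁺ Ex (proj₁ (∧-true⁻ {H (h x)} x∈preimageH))) Ux

  preimage-∖ : ∀ W → (U ∖ preimage W) ⊆ preimage (V ∖ W)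
  preimage-∖ W x p with W (h x) | ∧-true⁻ {U x} {not (preimage W x)} p
  ... | false | Ux , _          = ∧-true⁺ (∧-true⁺ (trans (V∘h≗U x) Ux) refl) Ux
  ... | true  | Ux , x∉preimage = contradiction (trans (cong not (sym Ux)) x∉preimage) λ ()

  preimage-empty : ∀ {W} → IsEmpty W → IsEmpty (preimage W)
  preimage-empty W-empty x = cong (_∧ U x) (W-empty (h x))

  pushforward : Family Γ → Family Δ
  pushforward F W = ⌊ ⊆-dec Δ-exhaustible W V ⌋ ∧ F (preimage W)

  module _ (F : Family Γ) where

    pushforward-true⁺ : ∀ {W} → W ⊆ V → F (preimage W) ≡ true → pushforward F W ≡ true
    pushforward-true⁺ {W} W⊆V = ∧-true⁺ (⌊⌋-true⁺ (⊆-dec Δ-exhaustible W V) W⊆V)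

    pushforward-true⁻ : ∀ {W} → pushforward F W ≡ true → W ⊆ V × F (preimage W) ≡ true
    pushforward-true⁻ {W} = Product.map₁ (⌊⌋-true⁻ (⊆-dec Δ-exhaustible W V)) ∘ ∧-true⁻

  module _ {F : Family Γ} (isSF : IsSemiFilter U F) where
    open IsSemiFilter isSF

    pushforward-isSemiFilter : IsSemiFilter V (pushforward F)
    pushforward-isSemiFilter = record
      { within   = λ W → proj₁ ∘ pushforward-true⁻ F
      ; nonempty = V , pushforward-true⁺ F (λ _ → id) F∋preimageV
      ; no-empty = λ W p W-empty →
          no-empty (preimage W) (proj₂ (pushforward-true⁻ F p)) (preimage-empty W-empty)
      ; upward   = λ W W′ p W⊆W′ W′⊆V → pushforward-true⁺ F W′⊆V
          (upward _ _ (proj₂ (pushforward-true⁻ F p)) (preimage-mono W⊆W′) (preimage⊆U W′))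
      }
      where
      F∋preimageV : F (preimage V) ≡ true
      F∋preimageV = upward U _ (semiFilter-∋U isSF) U⊆preimageV (preimage⊆U V)

    pushforward-covers : ∀ {x} → Covers (pushforward F) x → Covers F (preimage² x)
    pushforward-covers {E , H} (FE , FH , F∌E∩H) =
      proj₂ (pushforward-true⁻ F FE) , proj₂ (pushforward-true⁻ F FH) , ¬-not F∌preimages
      where
      F∌preimages : F (preimage E ∩ preimage H) ≢ true
      F∌preimages F∋ = not-¬ (pushforward-true⁺ F E∩H⊆V
        (upward _ _ F∋ (preimage-∩ E H) (preimage⊆U (E ∩ H)))) F∌E∩H
        where
        E∩H⊆V : (E ∩ H) ⊆ V
        E∩H⊆V x = proj₁ (pushforward-true⁻ F FE) x ∘ proj₁ ∘ ∧-true⁻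

    pushforward-above : ∀ {I J} {gen : I → Subset Γ} {gen′ : J → Subset Δ} {a} →
      ContinuousAt gen gen′ h a → Above gen U F a → Above gen′ V (pushforward F) (h a)
    pushforward-above {gen′ = gen′} continuous above i a∈gen′i =
      let j , a∈genj , genj⊆ = continuous i a∈gen′i
      in  pushforward-true⁺ F {gen′ i ∩ V} (λ x → proj₂ ∘ ∧-true⁻)
            (upward _ _ (above j a∈genj) (⊆preimage-∩V {W = gen′ i} genj⊆)
                    (preimage⊆U (gen′ i ∩ V)))

  pushforward-isSemiUltraFilter : ∀ {F} → IsSemiUltraFilter U F → IsSemiUltraFilter V (pushforward F)
  pushforward-isSemiUltraFilter {F} isSUF = record
    { semiFilter = pushforward-isSemiFilter semiFilter
    ; ultra      = λ W W⊆V → Sum.map (pushforward-true⁺ F W⊆V) (complement-true W)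
                                     (ultra (preimage W) (preimage⊆U W))
    }
    where
    open IsSemiUltraFilter isSUF
    open IsSemiFilter semiFilter
    complement-true : ∀ W → F (U ∖ preimage W) ≡ true → pushforward F (V ∖ W) ≡ true
    complement-true W F∋ = pushforward-true⁺ F (λ x → proj₁ ∘ ∧-true⁻)
      (upward _ _ F∋ (preimage-∖ W) (preimage⊆U (V ∖ W)))

  preimage-isUltraCover : ∀ {I J} {gen : I → Subset Γ} {gen′ : J → Subset Δ} {L} →
    (∀ a → A a ≡ true → ContinuousAt gen gen′ h a) →
    IsUltraCover B gen′ L → IsUltraCover A gen (map preimage² L)
  preimage-isUltraCover continuous (_ , covered) =
    All.map⁺ (All.tabulate λ { {E , H} _ → preimage⊆U E , preimage⊆U H }) ,
    λ F isSUF a a∈A above → Any.map⁺ (Any.map (pushforward-covers (semiFilter isSUF))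
      (covered (pushforward F) (pushforward-isSemiUltraFilter isSUF) (h a)
        (trans (B∘h≗A a) a∈A) (pushforward-above (semiFilter isSUF) (continuous a a∈A) above)))
    where open IsSemiUltraFilter

≡ᵇ1-injective : ∀ {x y} → x < 2 → y < 2 → (x ≡ᵇ 1) ≡ (y ≡ᵇ 1) → x ≡ y
≡ᵇ1-injective {0}           {0}           _                _                _  = refl
≡ᵇ1-injective {1}           {1}           _                _                _  = refl
≡ᵇ1-injective {0}           {1}           _                _                ()
≡ᵇ1-injective {1}           {0}           _                _                ()
≡ᵇ1-injective {suc (suc _)} {_}           (s≤s (s≤s ())) _                _
≡ᵇ1-injective {_}           {suc (suc _)} _                (s≤s (s≤s ())) _

bitsLSB-injective : ∀ n {m m′} → m < 2 ^ n → m′ < 2 ^ n → bitsLSB n m ≡ bitsLSB n m′ → m ≡ m′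
bitsLSB-injective zero    m<1 m′<1 _ = trans (n<1⇒n≡0 m<1) (sym (n<1⇒n≡0 m′<1))
bitsLSB-injective (suc n) {m} {m′} m<2^1+n m′<2^1+n bits≡ = begin
  m                   ≡⟨ m≡m%n+[m/n]*n m 2 ⟩
  m % 2 + m / 2 * 2   ≡⟨ cong₂ (λ r q → r + q * 2) lowest≡ higher≡ ⟩
  m′ % 2 + m′ / 2 * 2 ≡⟨ sym (m≡m%n+[m/n]*n m′ 2) ⟩
  m′                  ∎
  where
  open ≡-Reasoning
  half< : ∀ {k} → k < 2 ^ suc n → k / 2 < 2 ^ n
  half< {k} k< = m<n*o⇒m/o<n (subst (k <_) (*-comm 2 (2 ^ n)) k<)
  lowest≡ : m % 2 ≡ m′ % 2
  lowest≡ = ≡ᵇ1-injective (m%n<n m 2) (m%n<n m′ 2) (proj₁ (∷-injective bits≡))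
  higher≡ : m / 2 ≡ m′ / 2
  higher≡ = bitsLSB-injective n (half< m<2^1+n) (half< m′<2^1+n) (proj₂ (∷-injective bits≡))

bin-injective : ∀ n {u v} → bin n u ≡ bin n v → u ≡ v
bin-injective n {u} {v} =
  toℕ-injective ∘ bitsLSB-injective n (toℕ<n u) (toℕ<n v) ∘ reverse-injective

φ-injective : ∀ n {p q} → φ n p ≡ φ n q → p ≡ q
φ-injective n {u , v} {u′ , v′} φp≡φq =
  let bin-u≡ , bin-v≡ = ++-injective (bin n u) (bin n u′) φp≡φq
  in  cong₂ _,_ (bin-injective n bin-u≡) (bin-injective n bin-v≡)

anyFin-true⁺ : ∀ {m} (p : Fin m → Bool) i → p i ≡ true → anyFin p ≡ true
anyFin-true⁺ p Fin.zero    p0 = cong (_∨ anyFin (p ∘ Fin.suc)) p0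
anyFin-true⁺ p (Fin.suc i) p[1+i] =
  trans (cong (p Fin.zero ∨_) (anyFin-true⁺ (p ∘ Fin.suc) i p[1+i])) (∨-zeroʳ (p Fin.zero))

anyFin-true⁻ : ∀ {m} (p : Fin m → Bool) → anyFin p ≡ true → ∃ λ i → p i ≡ true
anyFin-true⁻ {suc m} p any with p Fin.zero in p0
... | true  = Fin.zero , p0
... | false = Product.map Fin.suc id (anyFin-true⁻ (p ∘ Fin.suc) any)

module _ (n : ℕ) (G : Graph (2 ^ n)) where

  φ[G]⊆fG⁻¹1 : ∀ {p} → G p ≡ true → fG⁻¹1 n G (φ n p) ≡ true
  φ[G]⊆fG⁻¹1 {u , v} Gp = anyFin-true⁺ _ u (anyFin-true⁺ _ v
    (∧-true⁺ Gp (⌊⌋-true⁺ (≡-dec Bool._≟_ (φ n (u , v)) (φ n (u , v))) refl)))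

  fG⁻¹1⊆φ[G] : ∀ {w} → fG⁻¹1 n G w ≡ true → ∃ λ q → G q ≡ true × φ n q ≡ w
  fG⁻¹1⊆φ[G] {w} w∈ =
    let u , ∃v = anyFin-true⁻ _ w∈
        v , p  = anyFin-true⁻ _ ∃v
        Gq , φq≡w = ∧-true⁻ {G (u , v)} p
    in  (u , v) , Gq , ⌊⌋-true⁻ (≡-dec Bool._≟_ (φ n (u , v)) w) φq≡w

  fG⁻¹1∘φ≗G : fG⁻¹1 n G ∘ φ n ≗ G
  fG⁻¹1∘φ≗G p with G p in Gp
  ... | true  = φ[G]⊆fG⁻¹1 Gp
  ... | false = ¬-not λ φp∈ →
    let q , Gq , φq≡φp = fG⁻¹1⊆φ[G] φp∈
    in  not-¬ (subst (λ r → G r ≡ true) (φ-injective n φq≡φp) Gq) Gp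

module _ {A : Set} {m k} (xs : Vec A m) (ys : Vec A k) {i : Fin (m + k)} where

  lookup-++-splitAt-inj₁ : ∀ {j} → splitAt m i ≡ inj₁ j → lookup (xs ++ ys) i ≡ lookup xs j
  lookup-++-splitAt-inj₁ i↦j = trans (lookup-splitAt m xs ys i) (cong [ lookup xs , lookup ys ]′ i↦j)

  lookup-++-splitAt-inj₂ : ∀ {j} → splitAt m i ≡ inj₂ j → lookup (xs ++ ys) i ≡ lookup ys j
  lookup-++-splitAt-inj₂ i↦j = trans (lookup-splitAt m xs ys i) (cong [ lookup xs , lookup ys ]′ i↦j)

cubeGen-cong : ∀ m {i} b {v w : Vec Bool m} →
  lookup v i ≡ lookup w i → cubeGen m (i , b) v ≡ cubeGen m (i , b) w
cubeGen-cong m true  = id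
cubeGen-cong m false = cong not

φ-continuous : ∀ n a → ContinuousAt (gridGen (2 ^ n)) (cubeGen (n + n)) (φ n) a
φ-continuous n (u , v) (i , b) φa∈B with splitAt n i in i↦
... | inj₁ j = row u , ⌊⌋-true⁺ (u Fin.≟ u) refl , row⊆B
  where
  row⊆B : gridGen (2 ^ n) (row u) ⊆ (cubeGen (n + n) (i , b) ∘ φ n)
  row⊆B (u′ , v′) p with ⌊⌋-true⁻ (u′ Fin.≟ u) p
  ... | refl = trans (cubeGen-cong (n + n) b (trans
    (lookup-++-splitAt-inj₁ (bin n u) (bin n v′) i↦)
    (sym (lookup-++-splitAt-inj₁ (bin n u) (bin n v) i↦)))) φa∈B
... | inj₂ j = col v , ⌊⌋-true⁺ (v Fin.≟ v) refl , col⊆B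
  where
  col⊆B : gridGen (2 ^ n) (col v) ⊆ (cubeGen (n + n) (i , b) ∘ φ n)
  col⊆B (u′ , v′) p with ⌊⌋-true⁻ (v′ Fin.≟ v) p
  ... | refl = trans (cubeGen-cong (n + n) b (trans
    (lookup-++-splitAt-inj₂ (bin n u′) (bin n v) i↦)
    (sym (lookup-++-splitAt-inj₂ (bin n u) (bin n v) i↦)))) φa∈B

lemma4p12 : (n : ℕ) → 1 ≤ n → (G : Graph (2 ^ n)) →
    (L : List (Subset (Vec Bool (n + n)) × Subset (Vec Bool (n + n)))) →
    IsUltraCover (fG⁻¹1 n G) (cubeGen (n + n)) L →
    Σ (List (Subset (Fin (2 ^ n) × Fin (2 ^ n)) × Subset (Fin (2 ^ n) × Fin (2 ^ n))))
      (λ L′ → IsUltraCover G (gridGen (2 ^ n)) L′ × length L′ ≤ length L)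
lemma4p12 n _ G L cover =
  map preimage² L ,
  preimage-isUltraCover (λ a _ → φ-continuous n a) cover ,
  ≤-reflexive (length-map preimage² L)
  where
  open Pushforward (Vec-exhaustible Bool-exhaustible (n + n)) (φ n) {B = fG⁻¹1 n G} (fG⁻¹1∘φ≗G n G)
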